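{- If $F$ is a maximal hke collection, then $\bigcap F=\emptyset$.
   Context: A non-empty finite collection $F$ of finite sets is an \emph{hke collection} if there is a positive integer $\alpha$ such that $|\bigcup \Gamma|+|\bigcap \Gamma|=2\alpha$ for every non-empty subcollection $\Gamma\subseteq F$. An hke collection $F$ is \emph{maximal} if there is no hke collection $F'$ with $F\subsetneq F'$ (members of $F'$ may be arbitrary finite sets). -}

module Defs where

open import Data.Nat using (ℕ; _+_; _*_; _<_)
open import Data.List using (List; []; length)
open import Data.List.Membership.Propositional using (_∈_; _∉_)
open import Data.List.Relation.Unary.Linked using (Linked)
open import Data.List.Relation.Unary.All using (All)
open import Data.Product using (Σ; ∃; _×_; ∃-syntax)
open import Relation.Binary.PropositionalEquality using (_≡_; _≢_)
open import Function.Bundles using (_⇔_)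
open import Relation.Nullary using (¬_)

-- Ground universe: ℕ.  A finite set of naturals is represented canonically
-- as a strictly increasing list, so equality of sets is ≡ of lists.
FinSet : Set
FinSet = List ℕ

Canonical : FinSet → Set
Canonical = Linked _<_

Collection : Set
Collection = List FinSet

InUnion : Collection → ℕ → Set
InUnion Γ x = ∃[ A ] (A ∈ Γ × x ∈ A)

InInter : Collection → ℕ → Set
InInter Γ x = ∀ A → A ∈ Γ → x ∈ A

HasSize : (ℕ → Set) → ℕ → Set
HasSize S k = ∃[ L ] (Canonical L × (∀ x → (x ∈ L) ⇔ S x) × length L ≡ k)

_⊆ᶜ_ : Collection → Collection → Set
Γ ⊆ᶜ F = ∀ A → A ∈ Γ → A ∈ F

IsHke : Collection → Set
IsHke F =
  F ≢ [] × All Canonical F ×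
  ∃[ α ] (0 < α ×
    (∀ Γ → Γ ≢ [] → Γ ⊆ᶜ F →
      ∃[ u ] ∃[ i ] (HasSize (InUnion Γ) u × HasSize (InInter Γ) i × u + i ≡ 2 * α)))

_⊊ᶜ_ : Collection → Collection → Set
F ⊊ᶜ F' = F ⊆ᶜ F' × ∃[ A ] (A ∈ F' × A ∉ F)

IsMaximalHke : Collection → Set
IsMaximalHke F = IsHke F × (∀ F' → IsHke F' → ¬ (F ⊊ᶜ F'))

InterEmpty : Collection → Set
InterEmpty F = ∀ x → ¬ InInter F x

-- If x lies in every member of F, pick A ∈ F, a number y outside ⋃F, and put
-- B = (A ∖ {x}) ∪ {y}.  Then B ∉ F, yet B ∷ F is hke with the same α.  A
-- subcollection Γ ∋ B with some other member C has the union of A ∷ (Γ ∖ {B})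
-- plus y (x stays covered by C) and its intersection minus x (y lies in no
-- member of F); if Γ consists of B alone, its sizes are those of {A}, with x
-- traded for y.  This contradicts maximality.
module Submission where

open import Defs
open import Data.Nat using (ℕ; suc; _<_; _+_; s≤s)
import Data.Nat as ℕ
open import Data.Nat.Properties using (<-trans; <-irrefl; <⇒≢; >⇒≢; +-suc; +-comm)
open import Data.List using ([]; _∷_; _∷ʳ_; length; filter; concat)
open import Data.List.Properties using (≡-dec; length-++; filter-accept; filter-reject; filter-all)
open import Data.List.Extrema.Nat using (max; xs≤max)
open import Data.List.Membership.Propositional using (_∈_; _∉_; find)
open import Data.List.Membership.Propositional.Properties
  using (∈-++⁺ˡ; ∈-++⁺ʳ; ∈-++⁻; ∈-filter⁺; ∈-filter⁻; ∈-concat⁺′)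
open import Data.List.Membership.DecPropositional (≡-dec ℕ._≟_) using (_∈?_)
open import Data.List.Relation.Unary.Any using (here; there)
open import Data.List.Relation.Unary.All as All using (All; []; _∷_; all?)
open import Data.List.Relation.Unary.All.Properties using (¬All⇒Any¬)
open import Data.List.Relation.Unary.AllPairs as AllPairs using ()
open import Data.List.Relation.Unary.Linked as Linked using ([]; [-]; _∷_)
open import Data.List.Relation.Unary.Linked.Properties using (Linked⇒AllPairs; filter⁺)
open import Data.Product using (∃-syntax; _×_; _,_; proj₁; proj₂)
open import Data.Sum using (inj₁; inj₂)
open import Data.Empty using (⊥-elim)
open import Function using (_∘_; id)
open import Function.Bundles using (mk⇔; Equivalence)
open import Level using (0ℓ)
open import Relation.Binary.PropositionalEquality using (_≡_; _≢_; refl; sym; trans; cong; subst; module ≡-Reasoning)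
open import Relation.Nullary using (Dec; yes; no; ¬?)
open import Relation.Unary using (Pred; _⊆_; _≐_; _∪_; _∖_; ｛_｝)
open import Relation.Unary.Properties using (≐-sym)

open Equivalence using (to; from)
open ≡-Reasoning

_≟ˢ_ : (A B : FinSet) → Dec (A ≡ B)
_≟ˢ_ = ≡-dec ℕ._≟_

Canonical-head : ∀ {a L} → Canonical (a ∷ L) → All (a <_) L
Canonical-head = AllPairs.head ∘ Linked⇒AllPairs <-trans

Canonical-∷ʳ : ∀ {L y} → Canonical L → All (_< y) L → Canonical (L ∷ʳ y)
Canonical-∷ʳ []      []           = [-]
Canonical-∷ʳ [-]     (a<y ∷ [])   = a<y ∷ [-]
Canonical-∷ʳ (r ∷ c) (_ ∷ rest<y) = r ∷ Canonical-∷ʳ c rest<y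

remove : ℕ → FinSet → FinSet
remove x = filter (¬? ∘ (x ℕ.≟_))

length-remove : ∀ {x L} → Canonical L → x ∈ L → length L ≡ suc (length (remove x L))
length-remove {x} {_ ∷ L} c (here refl) = cong (suc ∘ length) (sym (begin
  remove x (x ∷ L)  ≡⟨ filter-reject (¬? ∘ (x ℕ.≟_)) (λ x≢x → x≢x refl) ⟩
  remove x L        ≡⟨ filter-all (¬? ∘ (x ℕ.≟_)) (All.map <⇒≢ (Canonical-head c)) ⟩
  L                 ∎))
length-remove {x} {a ∷ L} c (there x∈L) = cong suc (begin
  length L                      ≡⟨ length-remove (Linked.tail c) x∈L ⟩
  length (a ∷ remove x L)       ≡⟨ cong length (sym (filter-accept (¬? ∘ (x ℕ.≟_)) x≢a)) ⟩
  length (remove x (a ∷ L))     ∎)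
  where
  x≢a : x ≢ a
  x≢a = >⇒≢ (All.lookup (Canonical-head c) x∈L)

HasSize-self : ∀ {L} → Canonical L → HasSize (_∈ L) (length L)
HasSize-self {L} c = L , c , (λ _ → mk⇔ id id) , refl

HasSize-resp-≐ : ∀ {S T : Pred ℕ 0ℓ} {k} → S ≐ T → HasSize S k → HasSize T k
HasSize-resp-≐ (S⊆T , T⊆S) (L , c , L⇔S , len) =
  L , c , (λ z → mk⇔ (S⊆T ∘ to (L⇔S z)) (from (L⇔S z) ∘ T⊆S)) , len

HasSize-remove : ∀ {S : Pred ℕ 0ℓ} {k x} → HasSize S k → S x →
                 ∃[ k′ ] (k ≡ suc k′ × HasSize (S ∖ ｛ x ｝) k′)
HasSize-remove {S} {x = x} (L , c , L⇔S , refl) Sx =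
  length (remove x L) , length-remove c (from (L⇔S x) Sx) ,
  remove x L , filter⁺ (¬? ∘ (x ℕ.≟_)) <-trans c , (λ z → mk⇔ (⇒S∖x z) (S∖x⇒ z)) , refl
  where
  ⇒S∖x : ∀ z → z ∈ remove x L → (S ∖ ｛ x ｝) z
  ⇒S∖x z m with ∈-filter⁻ (¬? ∘ (x ℕ.≟_)) m
  ... | z∈L , x≢z = to (L⇔S z) z∈L , x≢z
  S∖x⇒ : ∀ z → (S ∖ ｛ x ｝) z → z ∈ remove x L
  S∖x⇒ z (Sz , x≢z) = ∈-filter⁺ (¬? ∘ (x ℕ.≟_)) (from (L⇔S z) Sz) x≢z

HasSize-insert : ∀ {S : Pred ℕ 0ℓ} {k y} → S ⊆ (_< y) → HasSize S k →
                 HasSize (｛ y ｝ ∪ S) (suc k)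
HasSize-insert {S} {y = y} S<y (L , c , L⇔S , refl) =
  L ∷ʳ y , Canonical-∷ʳ c (All.tabulate (S<y ∘ to (L⇔S _))) ,
  (λ z → mk⇔ (⇒y∪S z) (y∪S⇒ z)) , trans (length-++ L) (+-comm (length L) 1)
  where
  ⇒y∪S : ∀ z → z ∈ L ∷ʳ y → (｛ y ｝ ∪ S) z
  ⇒y∪S z m with ∈-++⁻ L m
  ... | inj₁ z∈L         = inj₂ (to (L⇔S z) z∈L)
  ... | inj₂ (here refl) = inj₁ refl
  y∪S⇒ : ∀ z → (｛ y ｝ ∪ S) z → z ∈ L ∷ʳ y
  y∪S⇒ z (inj₁ refl) = ∈-++⁺ʳ L (here refl)
  y∪S⇒ z (inj₂ Sz)   = ∈-++⁺ˡ (from (L⇔S z) Sz)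

UnionInterSum : Collection → ℕ → Set
UnionInterSum Γ n =
  ∃[ u ] ∃[ i ] (HasSize (InUnion Γ) u × HasSize (InInter Γ) i × u + i ≡ n)

InUnion-mono : ∀ {Γ Δ} → Γ ⊆ᶜ Δ → InUnion Γ ⊆ InUnion Δ
InUnion-mono Γ⊆Δ (C , C∈Γ , z∈C) = C , Γ⊆Δ C C∈Γ , z∈C

InUnion-<-suc-max : ∀ F → InUnion F ⊆ (_< suc (max 0 (concat F)))
InUnion-<-suc-max F (C , C∈F , z∈C) = s≤s (All.lookup (xs≤max 0 (concat F)) (∈-concat⁺′ z∈C C∈F))

module _ {Γ : Collection} {B : FinSet} (Γ≡B : All (_≡ B) Γ) (B∈Γ : B ∈ Γ) where

  InUnion-constant : InUnion Γ ≐ (_∈ B)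
  InUnion-constant =
    (λ { (C , C∈Γ , z∈C) → subst (_ ∈_) (All.lookup Γ≡B C∈Γ) z∈C }) ,
    (λ z∈B → B , B∈Γ , z∈B)

  InInter-constant : InInter Γ ≐ (_∈ B)
  InInter-constant =
    (λ z∈⋂Γ → z∈⋂Γ B B∈Γ) ,
    (λ z∈B C C∈Γ → subst (_ ∈_) (sym (All.lookup Γ≡B C∈Γ)) z∈B)

exchanged-set : ∀ {A x y} → Canonical A → x ∈ A → (_∈ A) ⊆ (_< y) →
                ∃[ B ] (Canonical B × (_∈ B) ≐ ｛ y ｝ ∪ ((_∈ A) ∖ ｛ x ｝))
exchanged-set canA x∈A A<y with HasSize-remove (HasSize-self canA) x∈A
... | _ , _ , A∖x with HasSize-insert (A<y ∘ proj₁) A∖x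
... | B , canB , B⇔ , _ = B , canB , (λ {z} → to (B⇔ z)) , (λ {z} → from (B⇔ z))

module Exchange
  {F : Collection} {A B : FinSet} {x y : ℕ}
  (x∈⋂F : InInter F x) (A∈F : A ∈ F) (⋃F<y : InUnion F ⊆ (_< y))
  (B≐ : (_∈ B) ≐ ｛ y ｝ ∪ ((_∈ A) ∖ ｛ x ｝))
  where

  y∈B : y ∈ B
  y∈B = proj₂ B≐ (inj₁ refl)

  B∉F : B ∉ F
  B∉F B∈F = <-irrefl refl (⋃F<y (B , B∈F , y∈B))

  ∈B-intro : ∀ {z} → z ∈ A → x ≢ z → z ∈ B
  ∈B-intro z∈A x≢z = proj₂ B≐ (inj₂ (z∈A , x≢z))

  HasSize-exchange : ∀ {k} → HasSize (_∈ A) k → HasSize (_∈ B) k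
  HasSize-exchange |A| with HasSize-remove |A| (x∈⋂F A A∈F)
  ... | _ , refl , |A∖x| =
    HasSize-resp-≐ (≐-sym B≐) (HasSize-insert (λ (z∈A , _) → ⋃F<y (A , A∈F , z∈A)) |A∖x|)

  module _ {Γ : Collection} (Γ⊆B∷F : Γ ⊆ᶜ (B ∷ F)) where

    ∈F-unless-B : ∀ {C} → C ∈ Γ → C ≢ B → C ∈ F
    ∈F-unless-B C∈Γ C≢B with Γ⊆B∷F _ C∈Γ
    ... | here C≡B  = ⊥-elim (C≢B C≡B)
    ... | there C∈F = C∈F

    ⊆ᶜF-if-B∉ : B ∉ Γ → Γ ⊆ᶜ F
    ⊆ᶜF-if-B∉ B∉Γ C C∈Γ = ∈F-unless-B C∈Γ (λ { refl → B∉Γ C∈Γ })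

    others : Collection
    others = filter (¬? ∘ (_≟ˢ B)) Γ

    ∈-others⁻ : ∀ {C} → C ∈ others → C ∈ Γ × C ≢ B
    ∈-others⁻ = ∈-filter⁻ (¬? ∘ (_≟ˢ B)) {xs = Γ}

    ∈-others⁺ : ∀ {C} → C ∈ Γ → C ≢ B → C ∈ others
    ∈-others⁺ = ∈-filter⁺ (¬? ∘ (_≟ˢ B))

    exchanged : Collection
    exchanged = A ∷ others

    exchanged⊆ᶜF : exchanged ⊆ᶜ F
    exchanged⊆ᶜF C (here refl) = A∈F
    exchanged⊆ᶜF C (there C∈others) = let C∈Γ , C≢B = ∈-others⁻ C∈others in ∈F-unless-B C∈Γ C≢B

    module _ (B∈Γ : B ∈ Γ) {C₁ : FinSet} (C₁∈Γ : C₁ ∈ Γ) (C₁≢B : C₁ ≢ B) where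

      InUnion-exchanged : InUnion Γ ≐ ｛ y ｝ ∪ InUnion exchanged
      InUnion-exchanged = ⇒ , ⇐
        where
        ⇒ : InUnion Γ ⊆ ｛ y ｝ ∪ InUnion exchanged
        ⇒ (C , C∈Γ , z∈C) with C ≟ˢ B
        ... | no C≢B = inj₂ (C , there (∈-others⁺ C∈Γ C≢B) , z∈C)
        ... | yes refl with proj₁ B≐ z∈C
        ...   | inj₁ y≡z       = inj₁ y≡z
        ...   | inj₂ (z∈A , _) = inj₂ (A , here refl , z∈A)
        ⇐ : ｛ y ｝ ∪ InUnion exchanged ⊆ InUnion Γ
        ⇐ (inj₁ refl) = B , B∈Γ , y∈B
        ⇐ (inj₂ (C , there C∈others , z∈C)) = C , proj₁ (∈-others⁻ C∈others) , z∈C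
        ⇐ {z} (inj₂ (_ , here refl , z∈A)) with x ℕ.≟ z
        ... | yes refl = C₁ , C₁∈Γ , x∈⋂F C₁ (∈F-unless-B C₁∈Γ C₁≢B)
        ... | no x≢z   = B , B∈Γ , ∈B-intro z∈A x≢z

      InInter-exchanged : InInter Γ ≐ InInter exchanged ∖ ｛ x ｝
      InInter-exchanged = ⇒ , ⇐
        where
        ⇒ : InInter Γ ⊆ InInter exchanged ∖ ｛ x ｝
        ⇒ z∈⋂Γ with proj₁ B≐ (z∈⋂Γ B B∈Γ)
        ... | inj₁ refl =
          ⊥-elim (<-irrefl refl (⋃F<y (C₁ , ∈F-unless-B C₁∈Γ C₁≢B , z∈⋂Γ C₁ C₁∈Γ)))
        ... | inj₂ (z∈A , x≢z) =
          (λ { _ (here refl) → z∈A ; C (there C∈others) → z∈⋂Γ C (proj₁ (∈-others⁻ C∈others)) }) ,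
          x≢z
        ⇐ : InInter exchanged ∖ ｛ x ｝ ⊆ InInter Γ
        ⇐ (z∈⋂Γ′ , x≢z) C C∈Γ with C ≟ˢ B
        ... | yes refl = ∈B-intro (z∈⋂Γ′ A (here refl)) x≢z
        ... | no C≢B   = z∈⋂Γ′ C (there (∈-others⁺ C∈Γ C≢B))

      UnionInterSum-exchanged : ∀ {n} → UnionInterSum exchanged n → UnionInterSum Γ n
      UnionInterSum-exchanged (u , i , |⋃| , |⋂| , u+i≡n)
        with HasSize-remove |⋂| (λ C C∈Γ′ → x∈⋂F C (exchanged⊆ᶜF C C∈Γ′))
      ... | i′ , refl , |⋂∖x| =
        suc u , i′ ,
        HasSize-resp-≐ (≐-sym InUnion-exchanged)
          (HasSize-insert (⋃F<y ∘ InUnion-mono exchanged⊆ᶜF) |⋃|) ,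
        HasSize-resp-≐ (≐-sym InInter-exchanged) |⋂∖x| ,
        trans (sym (+-suc u i′)) u+i≡n

  UnionInterSum-only-B : ∀ {n Γ} → All (_≡ B) Γ → B ∈ Γ →
                         UnionInterSum (A ∷ []) n → UnionInterSum Γ n
  UnionInterSum-only-B {Γ = Γ} Γ≡B B∈Γ (u , i , |⋃A| , |⋂A| , u+i≡n) =
    u , i , exchange InUnion-constant |⋃A| , exchange InInter-constant |⋂A| , u+i≡n
    where
    exchange : ∀ {k} {Op : Collection → Pred ℕ 0ℓ} →
               (∀ {Δ D} → All (_≡ D) Δ → D ∈ Δ → Op Δ ≐ (_∈ D)) →
               HasSize (Op (A ∷ [])) k → HasSize (Op Γ) k
    exchange Op-constant =
      HasSize-resp-≐ (≐-sym (Op-constant Γ≡B B∈Γ)) ∘ HasSize-exchange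
      ∘ HasSize-resp-≐ (Op-constant (refl ∷ []) (here refl))

  UnionInterSum-∷ : ∀ {n} → (∀ Γ → Γ ≢ [] → Γ ⊆ᶜ F → UnionInterSum Γ n) →
                    ∀ Γ → Γ ≢ [] → Γ ⊆ᶜ (B ∷ F) → UnionInterSum Γ n
  UnionInterSum-∷ sums Γ Γ≢[] Γ⊆B∷F with B ∈? Γ
  ... | no B∉Γ = sums Γ Γ≢[] (⊆ᶜF-if-B∉ Γ⊆B∷F B∉Γ)
  ... | yes B∈Γ with all? (_≟ˢ B) Γ
  ...   | yes Γ≡B = UnionInterSum-only-B Γ≡B B∈Γ (sums (A ∷ []) (λ ()) λ { _ (here refl) → A∈F })
  ...   | no Γ≢B  with find (¬All⇒Any¬ (_≟ˢ B) Γ Γ≢B)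
  ...     | _ , C₁∈Γ , C₁≢B =
    UnionInterSum-exchanged Γ⊆B∷F B∈Γ C₁∈Γ C₁≢B
      (sums (exchanged Γ⊆B∷F) (λ ()) (exchanged⊆ᶜF Γ⊆B∷F))

mainTheorem12 : (F : Collection) → IsMaximalHke F → InterEmpty F
mainTheorem12 [] ((F≢[] , _) , _) _ _ = F≢[] refl
mainTheorem12 F@(A ∷ _) ((_ , canF@(canA ∷ _) , α , 0<α , sums) , maximal) x x∈⋂F
  with exchanged-set canA (x∈⋂F A (here refl)) (λ z∈A → InUnion-<-suc-max F (A , here refl , z∈A))
... | B , canB , B≐ =
  maximal (B ∷ F) ((λ ()) , canB ∷ canF , α , 0<α , UnionInterSum-∷ sums)
          ((λ _ → there) , B , here refl , B∉F)
  where open Exchange x∈⋂F (here refl) (InUnion-<-suc-max F) B≐
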